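{- Let $\Omega$ be a set of orderings containing an independent element. Then $\Omega$ is balanced.
   Context: Let $S$ be a finite set. A set of orderings $\Omega$ on $S$ is a nonempty set of total orderings (permutations) of $S$; the members of $S$ are the elements of $\Omega$ and the members of $\Omega$ are its orderings. For distinct elements $x,y$, $\Pr[x<y]$ denotes the probability that $x$ occurs earlier than $y$ in an ordering chosen uniformly at random from $\Omega$. A pair $x,y$ of distinct elements is a balanced pair if $\frac13\le \Pr[x<y]\le \frac23$. $\Omega$ is called balanced if it contains a balanced pair or consists of a single ordering. An element $x$ is an independent element of $\Omega$ if, in every ordering of $\Omega$, swapping $x$ with either of the elements adjacent to it in that ordering produces another ordering that belongs to $\Omega$. -}

module Defs where

open import Data.Nat using (ℕ; _*_; _≤_)
open import Data.Fin using (Fin; _≟_)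
open import Data.Bool using (Bool; true; false)
open import Data.List using (List; []; _∷_; _++_; length; filter; allFin)
open import Data.List.Membership.Propositional using (_∈_)
open import Data.List.Relation.Unary.All using (All)
open import Data.List.Relation.Unary.Unique.Propositional using (Unique)
open import Data.List.Relation.Binary.Permutation.Propositional using (_↭_)
open import Data.Product using (_×_; ∃-syntax)
open import Data.Sum using (_⊎_)
open import Relation.Binary.PropositionalEquality using (_≡_; _≢_)
open import Relation.Nullary using (does)

-- The finite ground set S is (w.l.o.g.) Fin n.
-- A total ordering of S is a list listing every element of S exactly once.
Ordering : ℕ → Set
Ordering n = List (Fin n)

IsTotalOrdering : ∀ {n} → Ordering n → Set
IsTotalOrdering {n} σ = σ ↭ allFin n

IsSetOfOrderings : ∀ {n} → List (Ordering n) → Set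
IsSetOfOrderings Ω = All IsTotalOrdering Ω × Unique Ω × Ω ≢ []

occurs : ∀ {n} → Fin n → List (Fin n) → Bool
occurs y [] = false
occurs y (z ∷ zs) with does (z ≟ y)
... | true = true
... | false = occurs y zs

before : ∀ {n} → Fin n → Fin n → Ordering n → Bool
before x y [] = false
before x y (z ∷ zs) with does (z ≟ x)
... | true = occurs y zs
... | false with does (z ≟ y)
...   | true = false
...   | false = before x y zs

-- number of orderings of Ω in which x occurs earlier than y;
-- Pr[x<y] = countBefore x y Ω / length Ω
countBefore : ∀ {n} → Fin n → Fin n → List (Ordering n) → ℕ
countBefore x y Ω = length (filter (λ σ → Data.Bool.T? (before x y σ)) Ω)

-- 1/3 ≤ Pr[x<y] ≤ 2/3, cleared of denominators
BalancedPair : ∀ {n} → List (Ordering n) → Fin n → Fin n → Set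
BalancedPair Ω x y =
  x ≢ y × length Ω ≤ 3 * countBefore x y Ω × 3 * countBefore x y Ω ≤ 2 * length Ω

Balanced : ∀ {n} → List (Ordering n) → Set
Balanced {n} Ω = (∃[ x ] ∃[ y ] BalancedPair Ω x y) ⊎ length Ω ≡ 1

IndependentElement : ∀ {n} → List (Ordering n) → Fin n → Set
IndependentElement {n} Ω x =
  ∀ (as bs : List (Fin n)) (a : Fin n) →
    ((as ++ a ∷ x ∷ bs) ∈ Ω → (as ++ x ∷ a ∷ bs) ∈ Ω) ×
    ((as ++ x ∷ a ∷ bs) ∈ Ω → (as ++ a ∷ x ∷ bs) ∈ Ω)

-- Let T be the set of orderings τ of S ∖ {x} with x ∷ τ ∈ Ω, and
-- M = |T|. Moving x one step at a time by swaps with its neighbours shows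
-- that Ω consists exactly of the n insertions of x into the members of T,
-- each arising once. Counting over this decomposition gives |Ω| = n·M,
-- #Ω[a<b] = n·c a b for a, b ≠ x, where c a b = #T[a<b], and
-- #Ω[x<y] = M + Σ_z c z y for y ≠ x, because x precedes y in exactly
-- pos(y)+1 of the insertions into τ, and pos(y) = #{z | z precedes y in τ}.
-- The rest is a counting argument on the matrix c alone: either some pair
-- a, b ≠ x has 1/3 ≤ c a b / M ≤ 2/3 (and is then balanced in Ω), or
-- "a beats b" (c a b > 2M/3) is a strict total order on S ∖ {x}; then the
-- element y beaten by exactly ⌊(n-1)/2⌋ others makes the pair x, y balanced.
module Submission where

open import Defs
open import Data.Nat using (ℕ; zero; suc; _+_; _*_; _≤_; _<_; z≤n; s≤s; _≤?_; _<?_; ⌊_/2⌋)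
open import Data.Nat.Properties hiding (_≟_)
open import Data.Nat.ListAction using (sum)
open import Data.Nat.ListAction.Properties using (sum-++; sum-↭)
open import Data.Nat.Tactic.RingSolver using (solve-∀)
open import Data.Fin using (Fin; zero; suc; toℕ; fromℕ<; punchOut; _≟_)
open import Data.Fin.Properties
  using (toℕ-fromℕ<; toℕ-injective; toℕ<n; punchOut-injective; injective⇒≤; any?)
open import Data.Bool using (Bool; true; false; T?)
open import Data.List using (List; []; _∷_; _++_; length; filter; allFin; map; cartesianProduct)
open import Data.List.Properties using (∷-injective; map-++; map-tabulate; length-tabulate; length-++)
open import Data.List.Membership.Propositional using (_∈_; _∉_)
open import Data.List.Membership.Propositional.Properties
  using (∈-map⁺; ∈-map⁻; ∈-filter⁺; ∈-filter⁻; ∈-∃++; ∈-allFin; ∈-cartesianProduct⁺; ∈-cartesianProduct⁻)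
open import Data.List.Relation.Unary.Any using (here; there)
open import Data.List.Relation.Unary.All using (All)
import Data.List.Relation.Unary.All as All
import Data.List.Relation.Unary.All.Properties as All
open import Data.List.Relation.Unary.AllPairs using ([]; _∷_)
open import Data.List.Relation.Unary.Unique.Propositional using (Unique)
open import Data.List.Relation.Unary.Unique.Propositional.Properties
  using (filter⁺; cartesianProduct⁺; allFin⁺)
open import Data.List.Relation.Binary.Permutation.Propositional using (_↭_; ↭-sym; ↭⇒↭ₛ)
open import Data.List.Relation.Binary.Permutation.Propositional.Properties
  using (∈-resp-↭; ↭-length; ↭-singleton-inv)
import Data.List.Relation.Binary.Permutation.Propositional.Properties as Perm
import Data.List.Relation.Binary.Permutation.Setoid.Properties as PermSetoid
open import Data.List.Membership.Propositional.Properties.WithK using (unique∧set⇒bag)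
open import Data.List.Relation.Binary.BagAndSetEquality using (∼bag⇒↭)
open import Data.Product using (∃; ∃₂; ∃-syntax; _×_; _,_; proj₁; proj₂)
open import Data.Sum using (_⊎_; inj₁; inj₂)
open import Data.Empty using (⊥; ⊥-elim)
open import Function using (_∘_; case_of_)
open import Function.Bundles using (mk⇔)
open import Relation.Nullary using (¬_; Dec; yes; no; does)
open import Relation.Nullary.Decidable using (_×-dec_; ¬?; dec-true; dec-false)
open import Relation.Binary.PropositionalEquality

χ : Bool → ℕ
χ true = 1
χ false = 0

χ? : ∀ {p} {P : Set p} → Dec P → ℕ
χ? d = χ (does d)

χ?-yes : ∀ {p} {P : Set p} (d : Dec P) → P → χ? d ≡ 1
χ?-yes (yes _) _ = refl
χ?-yes (no ¬p) p = ⊥-elim (¬p p)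

χ?-no : ∀ {p} {P : Set p} (d : Dec P) → ¬ P → χ? d ≡ 0
χ?-no (yes p) ¬p = ⊥-elim (¬p p)
χ?-no (no _) _ = refl

χ?-mono : ∀ {p q} {P : Set p} {Q : Set q} → (P → Q) → (p? : Dec P) (q? : Dec Q) → χ? p? ≤ χ? q?
χ?-mono f (yes p) (yes q) = ≤-refl
χ?-mono f (yes p) (no ¬q) = ⊥-elim (¬q (f p))
χ?-mono f (no _) _ = z≤n

ΣL : ∀ {a} {A : Set a} → (A → ℕ) → List A → ℕ
ΣL f xs = sum (map f xs)

ΣF : ∀ n → (Fin n → ℕ) → ℕ
ΣF n f = ΣL f (allFin n)

module _ {a} {A : Set a} where

  Σ-cong : ∀ {f g : A → ℕ} xs → (∀ a → a ∈ xs → f a ≡ g a) → ΣL f xs ≡ ΣL g xs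
  Σ-cong [] h = refl
  Σ-cong (a ∷ xs) h = cong₂ _+_ (h a (here refl)) (Σ-cong xs (λ b i → h b (there i)))

  Σ-mono : ∀ {f g : A → ℕ} xs → (∀ a → a ∈ xs → f a ≤ g a) → ΣL f xs ≤ ΣL g xs
  Σ-mono [] h = z≤n
  Σ-mono (a ∷ xs) h = +-mono-≤ (h a (here refl)) (Σ-mono xs (λ b i → h b (there i)))

  Σ-mono-< : ∀ {f g : A → ℕ} xs → (∀ a → a ∈ xs → f a ≤ g a) →
             ∀ {w} → w ∈ xs → f w < g w → ΣL f xs < ΣL g xs
  Σ-mono-< (a ∷ xs) h (here refl) lt = +-mono-<-≤ lt (Σ-mono xs (λ b i → h b (there i)))
  Σ-mono-< (a ∷ xs) h (there w∈) lt =
    +-mono-≤-< (h a (here refl)) (Σ-mono-< xs (λ b i → h b (there i)) w∈ lt)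

  Σ-+ : ∀ (f g : A → ℕ) xs → ΣL (λ a → f a + g a) xs ≡ ΣL f xs + ΣL g xs
  Σ-+ f g [] = refl
  Σ-+ f g (a ∷ xs) rewrite Σ-+ f g xs = interchange (f a) (g a) (ΣL f xs) (ΣL g xs)
    where
    interchange : ∀ p q r s → p + q + (r + s) ≡ p + r + (q + s)
    interchange = solve-∀

  Σ-* : ∀ k (f : A → ℕ) xs → ΣL (λ a → k * f a) xs ≡ k * ΣL f xs
  Σ-* k f [] = sym (*-zeroʳ k)
  Σ-* k f (a ∷ xs) rewrite Σ-* k f xs = sym (*-distribˡ-+ k (f a) _)

  Σ-const : ∀ k (xs : List A) → ΣL (λ _ → k) xs ≡ length xs * k
  Σ-const k [] = refl
  Σ-const k (a ∷ xs) = cong (k +_) (Σ-const k xs)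

  Σ-1 : ∀ (xs : List A) → ΣL (λ _ → 1) xs ≡ length xs
  Σ-1 xs = trans (Σ-const 1 xs) (*-identityʳ _)

  Σ-zero : ∀ {f : A → ℕ} xs → (∀ a → a ∈ xs → f a ≡ 0) → ΣL f xs ≡ 0
  Σ-zero xs h = trans (Σ-cong xs h) (trans (Σ-const 0 xs) (*-zeroʳ (length xs)))

  Σ-↭ : ∀ (f : A → ℕ) {xs ys} → xs ↭ ys → ΣL f xs ≡ ΣL f ys
  Σ-↭ f p = sum-↭ (Perm.map⁺ f p)

  Σ-++ : ∀ (f : A → ℕ) xs ys → ΣL f (xs ++ ys) ≡ ΣL f xs + ΣL f ys
  Σ-++ f xs ys = trans (cong sum (map-++ f xs ys)) (sum-++ (map f xs) (map f ys))


Σ-comm : ∀ {a b} {A : Set a} {B : Set b} (g : A → B → ℕ) xs ys →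
         ΣL (λ x → ΣL (g x) ys) xs ≡ ΣL (λ y → ΣL (λ x → g x y) xs) ys
Σ-comm g [] ys = sym (Σ-zero ys (λ _ _ → refl))
Σ-comm g (a ∷ xs) ys =
  trans (cong (ΣL (g a) ys +_) (Σ-comm g xs ys)) (sym (Σ-+ (g a) _ ys))

Σ-map : ∀ {a b} {A : Set a} {B : Set b} (f : B → ℕ) (h : A → B) xs → ΣL f (map h xs) ≡ ΣL (f ∘ h) xs
Σ-map f h [] = refl
Σ-map f h (a ∷ xs) = cong (f (h a) +_) (Σ-map f h xs)

Σ-cartesian : ∀ {a b} {A : Set a} {B : Set b} (g : A × B → ℕ) xs ys →
              ΣL g (cartesianProduct xs ys) ≡ ΣL (λ a → ΣL (λ b → g (a , b)) ys) xs
Σ-cartesian g [] ys = refl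
Σ-cartesian g (a ∷ xs) ys = trans (Σ-++ g (map (a ,_) ys) (cartesianProduct xs ys))
  (cong₂ _+_ (Σ-map g (a ,_) ys) (Σ-cartesian g xs ys))

ΣF-suc : ∀ n (f : Fin (suc n) → ℕ) → ΣF (suc n) f ≡ f zero + ΣF n (f ∘ suc)
ΣF-suc n f = cong (λ l → f zero + sum l)
  (trans (map-tabulate suc f) (sym (map-tabulate (λ i → i) (f ∘ suc))))

ΣF-const : ∀ n k → ΣF n (λ _ → k) ≡ n * k
ΣF-const n k = trans (Σ-const k (allFin n)) (cong (_* k) (length-tabulate {n = n} (λ i → i)))

ΣF-single : ∀ n (a : Fin n) → ΣF n (λ z → χ? (z ≟ a)) ≡ 1
ΣF-single (suc n) zero = trans (ΣF-suc n (λ z → χ? (z ≟ zero))) (cong suc (Σ-zero (allFin n) (λ _ _ → refl)))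
ΣF-single (suc n) (suc a) = begin
    ΣF (suc n) (λ z → χ? (z ≟ suc a)) ≡⟨ ΣF-suc n (λ z → χ? (z ≟ suc a)) ⟩
    ΣF n (λ z → χ? (suc z ≟ suc a)) ≡⟨⟩
    ΣF n (λ z → χ? (z ≟ a)) ≡⟨ ΣF-single n a ⟩
    1 ∎
  where open ≡-Reasoning

not-both-above-⅔ : ∀ c c' {M} → c + c' ≡ M → 2 * M < 3 * c → 2 * M < 3 * c' → ⊥
not-both-above-⅔ c c' refl p q = m+1+n≰m (3 * (c + c')) (begin
    3 * (c + c') + suc (suc (c + c')) ≡⟨ reassoc c c' ⟩
    suc (2 * (c + c')) + suc (2 * (c + c')) ≤⟨ +-mono-≤ p q ⟩
    3 * c + 3 * c' ≡⟨ *-distribˡ-+ 3 c c' ⟨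
    3 * (c + c') ∎)
  where
  open ≤-Reasoning
  reassoc : ∀ c c' → 3 * (c + c') + suc (suc (c + c')) ≡ suc (2 * (c + c')) + suc (2 * (c + c'))
  reassoc = solve-∀

below-⅓⇒above-⅔ : ∀ c c' {M} → c + c' ≡ M → 3 * c < M → 2 * M < 3 * c'
below-⅓⇒above-⅔ c c' refl p = +-cancelˡ-≤ (3 * c) _ _ (begin
    3 * c + suc (2 * (c + c')) ≡⟨ +-suc (3 * c) _ ⟩
    suc (3 * c) + 2 * (c + c') ≤⟨ +-monoˡ-≤ (2 * (c + c')) p ⟩
    (c + c') + 2 * (c + c') ≡⟨ reassoc c c' ⟩
    3 * c + 3 * c' ∎)
  where
  open ≤-Reasoning
  reassoc : ∀ c c' → (c + c') + 2 * (c + c') ≡ 3 * c + 3 * c'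
  reassoc = solve-∀

above-⅔⇒below-⅓ : ∀ c c' {M} → c + c' ≡ M → 2 * M < 3 * c' → 3 * c < M
above-⅔⇒below-⅓ c c' refl p = +-cancelʳ-≤ (2 * (c + c')) _ _ (begin
    suc (3 * c) + 2 * (c + c') ≡⟨ +-suc (3 * c) _ ⟨
    3 * c + suc (2 * (c + c')) ≤⟨ +-monoʳ-≤ (3 * c) p ⟩
    3 * c + 3 * c' ≡⟨ reassoc c c' ⟩
    (c + c') + 2 * (c + c') ∎)
  where
  open ≤-Reasoning
  reassoc : ∀ c c' → 3 * c + 3 * c' ≡ (c + c') + 2 * (c + c')
  reassoc = solve-∀

not-all-three-above-⅔ : ∀ a b d {M} → a + b + d ≤ 2 * M →
                        2 * M < 3 * a → 2 * M < 3 * b → 2 * M < 3 * d → ⊥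
not-all-three-above-⅔ a b d {M} s p q r = m+1+n≰m (3 * (a + b + d)) (begin
    3 * (a + b + d) + 3 ≤⟨ +-monoˡ-≤ 3 (*-monoʳ-≤ 3 s) ⟩
    3 * (2 * M) + 3 ≡⟨ reassoc M ⟩
    suc (2 * M) + suc (2 * M) + suc (2 * M) ≤⟨ +-mono-≤ (+-mono-≤ p q) r ⟩
    3 * a + 3 * b + 3 * d ≡⟨ distrib a b d ⟩
    3 * (a + b + d) ∎)
  where
  open ≤-Reasoning
  reassoc : ∀ M → 3 * (2 * M) + 3 ≡ suc (2 * M) + suc (2 * M) + suc (2 * M)
  reassoc = solve-∀
  distrib : ∀ a b d → 3 * a + 3 * b + 3 * d ≡ 3 * (a + b + d)
  distrib = solve-∀

⌊/2⌋-bounds : ∀ m → 2 * ⌊ m /2⌋ ≤ m × m ≤ suc (2 * ⌊ m /2⌋)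
⌊/2⌋-bounds zero = z≤n , z≤n
⌊/2⌋-bounds (suc zero) = z≤n , s≤s z≤n
⌊/2⌋-bounds (suc (suc m)) with ⌊/2⌋-bounds m
... | lower , upper =
  subst (_≤ suc (suc m)) (sym (double-suc ⌊ m /2⌋)) (s≤s (s≤s lower)) ,
  subst (suc (suc m) ≤_) (sym (cong suc (double-suc ⌊ m /2⌋))) (s≤s (s≤s upper))
  where
  double-suc : ∀ h → 2 * suc h ≡ suc (suc (2 * h))
  double-suc = solve-∀

median-balanced : ∀ t s M E → 2 * s ≤ suc t → suc t ≤ suc (2 * s) →
                  2 * M * s ≤ 3 * E → 3 * E ≤ 2 * M * s + M * t →
                  (2 + t) * M ≤ 3 * (M + E) × 3 * (M + E) ≤ 2 * ((2 + t) * M)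
median-balanced t s M E 2s≤t+1 t+1≤2s+1 lower upper = lower-bound , upper-bound
  where
  open ≤-Reasoning
  lower-bound : (2 + t) * M ≤ 3 * (M + E)
  lower-bound = begin
    (2 + t) * M ≡⟨ regroup₁ t M ⟩
    M + suc t * M ≤⟨ +-monoʳ-≤ M (*-monoˡ-≤ M t+1≤2s+1) ⟩
    M + suc (2 * s) * M ≤⟨ m≤m+n _ M ⟩
    M + suc (2 * s) * M + M ≡⟨ regroup₂ s M ⟩
    3 * M + 2 * M * s ≤⟨ +-monoʳ-≤ (3 * M) lower ⟩
    3 * M + 3 * E ≡⟨ *-distribˡ-+ 3 M E ⟨
    3 * (M + E) ∎
    where
    regroup₁ : ∀ t M → (2 + t) * M ≡ M + suc t * M
    regroup₁ = solve-∀
    regroup₂ : ∀ s M → M + suc (2 * s) * M + M ≡ 3 * M + 2 * M * s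
    regroup₂ = solve-∀
  upper-bound : 3 * (M + E) ≤ 2 * ((2 + t) * M)
  upper-bound = begin
    3 * (M + E) ≡⟨ *-distribˡ-+ 3 M E ⟩
    3 * M + 3 * E ≤⟨ +-monoʳ-≤ (3 * M) upper ⟩
    3 * M + (2 * M * s + M * t) ≡⟨ regroup₁ M s t ⟩
    (3 + t) * M + (2 * s) * M ≤⟨ +-monoʳ-≤ ((3 + t) * M) (*-monoˡ-≤ M 2s≤t+1) ⟩
    (3 + t) * M + suc t * M ≡⟨ regroup₂ t M ⟩
    2 * ((2 + t) * M) ∎
    where
    regroup₁ : ∀ M s t → 3 * M + (2 * M * s + M * t) ≡ (3 + t) * M + (2 * s) * M
    regroup₁ = solve-∀
    regroup₂ : ∀ t M → (3 + t) * M + suc t * M ≡ 2 * ((2 + t) * M)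
    regroup₂ = solve-∀

injective⇒surjective : ∀ {m} (f : Fin m → Fin m) → (∀ {i j} → f i ≡ f j → i ≡ j) →
                       ∀ k → ∃ λ i → f i ≡ k
injective⇒surjective {suc m} f f-inj k with any? (λ i → f i ≟ k)
... | yes hit = hit
... | no miss = ⊥-elim (<-irrefl refl (injective⇒≤ {f = squeeze} squeeze-inj))
  where
  -- Missing k, f factors through Fin m, contradicting injectivity.
  squeeze : Fin (suc m) → Fin m
  squeeze i = punchOut {i = k} {j = f i} (λ e → miss (i , sym e))
  squeeze-inj : ∀ {i j} → squeeze i ≡ squeeze j → i ≡ j
  squeeze-inj {i} {j} e = f-inj (punchOut-injective (λ e → miss (i , sym e)) (λ e → miss (j , sym e)) e)

module _ {m} (x : Fin (suc m)) (r : Fin (suc m) → ℕ) (r<m : ∀ z → z ≢ x → r z < m)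
         (r-inj : ∀ {z w} → z ≢ x → w ≢ x → r z ≡ r w → z ≡ w) where

  private
    G : Fin (suc m) → ℕ
    G z with z ≟ x
    ... | yes _ = m
    ... | no _ = r z

    G<1+m : ∀ z → G z < suc m
    G<1+m z with z ≟ x
    ... | yes _ = n<1+n m
    ... | no z≢x = m<n⇒m<1+n (r<m z z≢x)

    G-inj : ∀ {z w} → G z ≡ G w → z ≡ w
    G-inj {z} {w} e with z ≟ x | w ≟ x
    ... | yes refl | yes refl = refl
    ... | yes _ | no w≢x = ⊥-elim (<-irrefl (sym e) (r<m w w≢x))
    ... | no z≢x | yes _ = ⊥-elim (<-irrefl e (r<m z z≢x))
    ... | no z≢x | no w≢x = r-inj z≢x w≢x e

    F : Fin (suc m) → Fin (suc m)
    F z = fromℕ< (G<1+m z)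

    F-inj : ∀ {z w} → F z ≡ F w → z ≡ w
    F-inj {z} {w} e = G-inj (trans (sym (toℕ-fromℕ< (G<1+m z))) (trans (cong toℕ e) (toℕ-fromℕ< (G<1+m w))))

    G-attains : ∀ s → s < m → ∃ λ y → G y ≡ s
    G-attains s s<m with injective⇒surjective F F-inj (fromℕ< (m<n⇒m<1+n s<m))
    ... | y , Fy≡s = y , trans (sym (toℕ-fromℕ< (G<1+m y))) (trans (cong toℕ Fy≡s) (toℕ-fromℕ< _))

  all-values-attained : ∀ s → s < m → ∃ λ y → y ≢ x × r y ≡ s
  all-values-attained s s<m with G-attains s s<m
  ... | y , Gy≡s with y ≟ x
  ...   | yes _ = ⊥-elim (<-irrefl (sym Gy≡s) s<m)
  ...   | no y≢x = y , y≢x , Gy≡s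

-- Let x : Fin (2 + t) and let c a b ≤ M be counts
-- ("how often a precedes b" among M orderings of the elements ≠ x) that
-- are complementary and satisfy the cyclic inequality of linear orders.
module Tournament {t : ℕ} (x : Fin (2 + t)) (M : ℕ) (c : Fin (2 + t) → Fin (2 + t) → ℕ)
  (c-complement : ∀ a b → a ≢ b → a ≢ x → b ≢ x → c a b + c b a ≡ M)
  (c-cyclic : ∀ a b d → a ≢ b → b ≢ d → d ≢ a → a ≢ x → b ≢ x → d ≢ x →
              c a b + c b d + c d a ≤ 2 * M)
  (c-x-left : ∀ y → c x y ≡ 0) (c-x-right : ∀ y → c y x ≡ 0) (c-diag : ∀ y → c y y ≡ 0)
  where

  BalancedOffX : Fin (2 + t) → Fin (2 + t) → Set
  BalancedOffX a b = a ≢ x × b ≢ x × a ≢ b × M ≤ 3 * c a b × 3 * c a b ≤ 2 * M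

  balancedOffX? : ∀ a b → Dec (BalancedOffX a b)
  balancedOffX? a b =
    ¬? (a ≟ x) ×-dec ¬? (b ≟ x) ×-dec ¬? (a ≟ b) ×-dec (M ≤? 3 * c a b) ×-dec (3 * c a b ≤? 2 * M)

  E : Fin (2 + t) → ℕ
  E y = ΣF (2 + t) (λ z → c z y)

  Outcome : Set
  Outcome = (∃₂ λ a b → BalancedOffX a b) ⊎
            (∃ λ y → y ≢ x × (2 + t) * M ≤ 3 * (M + E y) × 3 * (M + E y) ≤ 2 * ((2 + t) * M))

  Beats : Fin (2 + t) → Fin (2 + t) → Set
  Beats a b = 2 * M < 3 * c a b

  beats? : ∀ a b → Dec (Beats a b)
  beats? a b = 2 * M <? 3 * c a b

  zero-count-¬beats : ∀ {a b} → c a b ≡ 0 → ¬ Beats a b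
  zero-count-¬beats e beats rewrite e | *-zeroʳ 3 = <⇒≱ beats z≤n

  beats-distinct : ∀ {a b} → Beats a b → a ≢ x × b ≢ x × a ≢ b
  beats-distinct {a} {b} beats =
    (λ { refl → zero-count-¬beats (c-x-left b) beats }) ,
    (λ { refl → zero-count-¬beats (c-x-right a) beats }) ,
    (λ { refl → zero-count-¬beats (c-diag a) beats })

  beats-asym : ∀ {a b} → Beats a b → ¬ Beats b a
  beats-asym {a} {b} ab ba with beats-distinct ab
  ... | a≢x , b≢x , a≢b = not-both-above-⅔ (c a b) (c b a) (c-complement a b a≢b a≢x b≢x) ab ba

  beats-≤M : ∀ {a b} → Beats a b → c a b ≤ M
  beats-≤M {a} {b} ab with beats-distinct ab
  ... | a≢x , b≢x , a≢b = subst (c a b ≤_) (c-complement a b a≢b a≢x b≢x) (m≤m+n _ _)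

  others : Fin (2 + t) → Fin (2 + t) → ℕ
  others y z = χ? (¬? (z ≟ x) ×-dec ¬? (z ≟ y))

  Σ-others : ∀ y → y ≢ x → ΣF (2 + t) (others y) ≡ t
  Σ-others y y≢x = +-cancelʳ-≡ 2 _ t (begin
      ΣF (2 + t) (others y) + 2
        ≡⟨ cong (ΣF (2 + t) (others y) +_) (sym (cong₂ _+_ (ΣF-single (2 + t) x) (ΣF-single (2 + t) y))) ⟩
      ΣF (2 + t) (others y) + (ΣF (2 + t) (λ z → χ? (z ≟ x)) + ΣF (2 + t) (λ z → χ? (z ≟ y)))
        ≡⟨ cong (ΣF (2 + t) (others y) +_) (sym (Σ-+ (λ z → χ? (z ≟ x)) (λ z → χ? (z ≟ y)) (allFin (2 + t)))) ⟩
      ΣF (2 + t) (others y) + ΣF (2 + t) (λ z → χ? (z ≟ x) + χ? (z ≟ y))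
        ≡⟨ sym (Σ-+ (others y) (λ z → χ? (z ≟ x) + χ? (z ≟ y)) (allFin (2 + t))) ⟩
      ΣF (2 + t) (λ z → others y z + (χ? (z ≟ x) + χ? (z ≟ y)))
        ≡⟨ Σ-cong (allFin (2 + t)) (λ z _ → partition z) ⟩
      ΣF (2 + t) (λ _ → 1) ≡⟨ ΣF-const (2 + t) 1 ⟩
      (2 + t) * 1 ≡⟨ *-identityʳ (2 + t) ⟩
      2 + t ≡⟨ +-comm 2 t ⟩
      t + 2 ∎)
    where
    open ≡-Reasoning
    partition : ∀ z → others y z + (χ? (z ≟ x) + χ? (z ≟ y)) ≡ 1
    partition z with z ≟ x | z ≟ y
    ... | yes refl | yes refl = ⊥-elim (y≢x refl)
    ... | yes refl | no _ = refl
    ... | no _ | yes refl = refl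
    ... | no _ | no _ = refl

  -- Without a balanced pair off x, "beats" is a strict total order on the
  -- elements ≠ x; the element of median rank then balances with x.
  module Unbalanced (no-pair : ¬ (∃₂ λ a b → BalancedOffX a b)) where

    beats-total : ∀ {a b} → a ≢ b → a ≢ x → b ≢ x → ¬ Beats a b → Beats b a
    beats-total {a} {b} a≢b a≢x b≢x ¬ab = below-⅓⇒above-⅔ (c a b) (c b a) (c-complement a b a≢b a≢x b≢x) below
      where
      below : 3 * c a b < M
      below with M ≤? 3 * c a b
      ... | yes above = ⊥-elim (no-pair (a , b , a≢x , b≢x , a≢b , above , ≮⇒≥ ¬ab))
      ... | no ¬above = ≰⇒> ¬above

    beats-trans : ∀ {a b d} → Beats a b → Beats b d → Beats a d
    beats-trans {a} {b} {d} ab bd with beats? a d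
    ... | yes ad = ad
    ... | no ¬ad with beats-distinct ab | beats-distinct bd
    ...   | a≢x , b≢x , a≢b | _ , d≢x , b≢d =
      ⊥-elim (not-all-three-above-⅔ (c a b) (c b d) (c d a) {M}
        (c-cyclic a b d a≢b b≢d (λ d≡a → a≢d (sym d≡a)) a≢x b≢x d≢x) ab bd (beats-total a≢d a≢x d≢x ¬ad))
      where
      a≢d : a ≢ d
      a≢d refl = beats-asym ab bd

    rank : Fin (2 + t) → ℕ
    rank y = ΣF (2 + t) (λ z → χ? (beats? z y))

    rank-increasing : ∀ {y y'} → Beats y y' → rank y < rank y'
    rank-increasing {y} {y'} yy' = Σ-mono-< (allFin (2 + t)) pointwise (∈-allFin y) at-y
      where
      pointwise : ∀ z → z ∈ allFin (2 + t) → χ? (beats? z y) ≤ χ? (beats? z y')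
      pointwise z _ = χ?-mono (λ zy → beats-trans zy yy') (beats? z y) (beats? z y')
      at-y : χ? (beats? y y) < χ? (beats? y y')
      at-y rewrite χ?-no (beats? y y) (zero-count-¬beats (c-diag y)) | χ?-yes (beats? y y') yy' = s≤s z≤n

    rank-injective : ∀ {y y'} → y ≢ x → y' ≢ x → rank y ≡ rank y' → y ≡ y'
    rank-injective {y} {y'} y≢x y'≢x e with y ≟ y'
    ... | yes y≡y' = y≡y'
    ... | no y≢y' with beats? y y'
    ...   | yes yy' = ⊥-elim (<-irrefl e (rank-increasing yy'))
    ...   | no ¬yy' = ⊥-elim (<-irrefl (sym e) (rank-increasing (beats-total y≢y' y≢x y'≢x ¬yy')))

    rank-bound : ∀ y → y ≢ x → rank y < suc t
    rank-bound y y≢x = s≤s (subst (rank y ≤_) (Σ-others y y≢x) (Σ-mono (allFin (2 + t)) beaten-by-other))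
      where
      beaten-by-other : ∀ z → z ∈ allFin (2 + t) → χ? (beats? z y) ≤ others y z
      beaten-by-other z _ = χ?-mono z-is-other (beats? z y) (¬? (z ≟ x) ×-dec ¬? (z ≟ y))
        where
        z-is-other : Beats z y → z ≢ x × z ≢ y
        z-is-other zy = let z≢x , _ , z≢y = beats-distinct zy in z≢x , z≢y

    -- Each z beating y contributes between 2M/3 and M to 3 E y / 3, each
    -- other z ≠ x, y at most M/3.
    column-bounds : ∀ y → y ≢ x → 2 * M * rank y ≤ 3 * E y × 3 * E y ≤ 2 * M * rank y + M * t
    column-bounds y y≢x = lower , upper
      where
      open ≤-Reasoning
      N = 2 + t

      lower-term : ∀ z (d : Dec (Beats z y)) → 2 * M * χ? d ≤ 3 * c z y
      lower-term z (yes zy) = subst (_≤ 3 * c z y) (sym (*-identityʳ (2 * M))) (<⇒≤ zy)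
      lower-term z (no _) = subst (_≤ 3 * c z y) (sym (*-zeroʳ (2 * M))) z≤n

      not-beating : ∀ z → ¬ Beats z y → 3 * c z y ≤ M * others y z
      not-beating z ¬zy with z ≟ x | z ≟ y
      ... | yes refl | _ rewrite c-x-left y = z≤n
      ... | no _ | yes refl rewrite c-diag z = z≤n
      ... | no z≢x | no z≢y rewrite *-identityʳ M =
        <⇒≤ (above-⅔⇒below-⅓ (c z y) (c y z) (c-complement z y z≢y z≢x y≢x)
                              (beats-total z≢y z≢x y≢x ¬zy))

      upper-term : ∀ z (d : Dec (Beats z y)) → 3 * c z y ≤ 2 * M * χ? d + M * others y z
      upper-term z (yes zy) with beats-distinct zy
      ... | z≢x , _ , z≢y rewrite χ?-yes (¬? (z ≟ x) ×-dec ¬? (z ≟ y)) (z≢x , z≢y) = begin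
        3 * c z y ≤⟨ *-monoʳ-≤ 3 (beats-≤M zy) ⟩
        3 * M ≡⟨ thirds M ⟩
        2 * M * 1 + M * 1 ∎
        where
        thirds : ∀ M → 3 * M ≡ 2 * M * 1 + M * 1
        thirds = solve-∀
      upper-term z (no ¬zy) = ≤-trans (not-beating z ¬zy) (m≤n+m _ _)

      lower : 2 * M * rank y ≤ 3 * E y
      lower = begin
        2 * M * rank y ≡⟨ Σ-* (2 * M) (λ z → χ? (beats? z y)) (allFin N) ⟨
        ΣF N (λ z → 2 * M * χ? (beats? z y)) ≤⟨ Σ-mono (allFin N) (λ z _ → lower-term z (beats? z y)) ⟩
        ΣF N (λ z → 3 * c z y) ≡⟨ Σ-* 3 (λ z → c z y) (allFin N) ⟩
        3 * E y ∎

      upper : 3 * E y ≤ 2 * M * rank y + M * t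
      upper = begin
        3 * E y ≡⟨ Σ-* 3 (λ z → c z y) (allFin N) ⟨
        ΣF N (λ z → 3 * c z y) ≤⟨ Σ-mono (allFin N) (λ z _ → upper-term z (beats? z y)) ⟩
        ΣF N (λ z → 2 * M * χ? (beats? z y) + M * others y z) ≡⟨ Σ-+ (λ z → 2 * M * χ? (beats? z y)) (λ z → M * others y z) (allFin N) ⟩
        ΣF N (λ z → 2 * M * χ? (beats? z y)) + ΣF N (λ z → M * others y z)
          ≡⟨ cong₂ _+_ (Σ-* (2 * M) (λ z → χ? (beats? z y)) (allFin N)) (trans (Σ-* M (others y) (allFin N)) (cong (M *_) (Σ-others y y≢x))) ⟩
        2 * M * rank y + M * t ∎

    median : ∃ λ y → y ≢ x × rank y ≡ ⌊ suc t /2⌋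
    median = all-values-attained x rank rank-bound rank-injective ⌊ suc t /2⌋ (⌊n/2⌋<n t)

    median-outcome : Outcome
    median-outcome =
      let y , y≢x , rank≡s = median
          lower , upper = column-bounds y y≢x
          2s≤t+1 , t+1≤2s+1 = ⌊/2⌋-bounds (suc t)
      in inj₂ (y , y≢x , median-balanced t (rank y) M (E y)
           (subst (λ r → 2 * r ≤ suc t) (sym rank≡s) 2s≤t+1)
           (subst (λ r → suc t ≤ suc (2 * r)) (sym rank≡s) t+1≤2s+1)
           lower upper)

  tournament : Outcome
  tournament with any? (λ a → any? (λ b → balancedOffX? a b))
  ... | yes (a , b , balanced) = inj₁ (a , b , balanced)
  ... | no no-pair = Unbalanced.median-outcome no-pair

module _ {n : ℕ} where

  ∈-tail : ∀ {z w : Fin n} {zs} → z ≢ w → w ∈ z ∷ zs → w ∈ zs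
  ∈-tail z≢w (here refl) = ⊥-elim (z≢w refl)
  ∈-tail _ (there w∈) = w∈

  head-∉-tail : ∀ {z : Fin n} {zs} → Unique (z ∷ zs) → z ∉ zs
  head-∉-tail (z∉ ∷ _) z∈ = All.lookup z∉ z∈ refl

  unique-tail : ∀ {z : Fin n} {zs} → Unique (z ∷ zs) → Unique zs
  unique-tail (_ ∷ u) = u

  occurs-∈ : ∀ {y : Fin n} {zs} → y ∈ zs → occurs y zs ≡ true
  occurs-∈ {y} {z ∷ zs} y∈ with z ≟ y
  ... | yes _ = refl
  ... | no z≢y = occurs-∈ (∈-tail z≢y y∈)

  occurs-∉ : ∀ {y : Fin n} zs → y ∉ zs → occurs y zs ≡ false
  occurs-∉ [] _ = refl
  occurs-∉ {y} (z ∷ zs) y∉ with z ≟ y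
  ... | yes refl = ⊥-elim (y∉ (here refl))
  ... | no _ = occurs-∉ zs (y∉ ∘ there)

  occurs⇒∈ : ∀ {y : Fin n} zs → occurs y zs ≡ true → y ∈ zs
  occurs⇒∈ {y} (z ∷ zs) e with z ≟ y
  ... | yes refl = here refl
  ... | no _ = there (occurs⇒∈ zs e)

  before⇒∈ : ∀ {a b : Fin n} zs → before a b zs ≡ true → b ∈ zs
  before⇒∈ {a} {b} (z ∷ zs) e with z ≟ a
  ... | yes _ = there (occurs⇒∈ zs e)
  ... | no _ with z ≟ b
  ...   | yes refl = here refl
  ...   | no _ = there (before⇒∈ zs e)

  before-∉-left : ∀ {a b : Fin n} zs → a ∉ zs → before a b zs ≡ false
  before-∉-left [] _ = refl
  before-∉-left {a} {b} (z ∷ zs) a∉ with z ≟ a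
  ... | yes refl = ⊥-elim (a∉ (here refl))
  ... | no _ with z ≟ b
  ...   | yes _ = refl
  ...   | no _ = before-∉-left zs (a∉ ∘ there)

  before-∉-right : ∀ {a b : Fin n} zs → b ∉ zs → before a b zs ≡ false
  before-∉-right [] _ = refl
  before-∉-right {a} {b} (z ∷ zs) b∉ with z ≟ a
  ... | yes _ = occurs-∉ zs (b∉ ∘ there)
  ... | no _ with z ≟ b
  ...   | yes refl = ⊥-elim (b∉ (here refl))
  ...   | no _ = before-∉-right zs (b∉ ∘ there)

  before-irrefl : ∀ (a : Fin n) zs → Unique zs → before a a zs ≡ false
  before-irrefl a [] _ = refl
  before-irrefl a (z ∷ zs) u with z ≟ a
  ... | yes refl = occurs-∉ zs (head-∉-tail u)
  ... | no z≢a rewrite dec-false (z ≟ a) z≢a = before-irrefl a zs (unique-tail u)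

  occurs-here : ∀ (y : Fin n) zs → occurs y (y ∷ zs) ≡ true
  occurs-here y zs rewrite dec-true (y ≟ y) refl = refl

  occurs-skip : ∀ {y z : Fin n} zs → z ≢ y → occurs y (z ∷ zs) ≡ occurs y zs
  occurs-skip {y} {z} zs z≢y rewrite dec-false (z ≟ y) z≢y = refl

  before-here : ∀ (a b : Fin n) zs → before a b (a ∷ zs) ≡ occurs b zs
  before-here a b zs rewrite dec-true (a ≟ a) refl = refl

  before-blocked : ∀ {a b : Fin n} zs → b ≢ a → before a b (b ∷ zs) ≡ false
  before-blocked {a} {b} zs b≢a rewrite dec-false (b ≟ a) b≢a | dec-true (b ≟ b) refl = refl

  before-skip : ∀ {a b z : Fin n} zs → z ≢ a → z ≢ b → before a b (z ∷ zs) ≡ before a b zs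
  before-skip {a} {b} {z} zs z≢a z≢b rewrite dec-false (z ≟ a) z≢a | dec-false (z ≟ b) z≢b = refl

  false≢true : false ≢ true
  false≢true ()

  -- The case splits below use `case_of_` rather than `with`, so that the goal
  -- keeps the form `before a b (z ∷ zs)` and the unfolding lemmas apply.

  before-total : ∀ {a b : Fin n} zs → a ∈ zs → b ∈ zs → a ≢ b →
                 χ (before a b zs) + χ (before b a zs) ≡ 1
  before-total {a} {b} (z ∷ zs) a∈ b∈ a≢b = case ((z ≟ a) , (z ≟ b)) of λ where
    (yes refl , yes refl) → ⊥-elim (a≢b refl)
    (yes refl , no z≢b) → cong₂ _+_
      (cong χ (trans (before-here z b zs) (occurs-∈ (∈-tail z≢b b∈)))) (cong χ (before-blocked zs z≢b))
    (no z≢a , yes refl) → cong₂ _+_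
      (cong χ (before-blocked zs z≢a)) (cong χ (trans (before-here z a zs) (occurs-∈ (∈-tail z≢a a∈))))
    (no z≢a , no z≢b) → trans
      (cong₂ _+_ (cong χ (before-skip zs z≢a z≢b)) (cong χ (before-skip zs z≢b z≢a)))
      (before-total zs (∈-tail z≢a a∈) (∈-tail z≢b b∈) a≢b)

  before-trans : ∀ {a b d : Fin n} zs → before a b zs ≡ true → before b d zs ≡ true → before a d zs ≡ true
  before-trans {a} {b} {d} (z ∷ zs) ab bd = case ((z ≟ a) , (z ≟ b) , (z ≟ d)) of λ where
    (yes refl , yes refl , _) → bd
    (yes refl , no z≢b , yes refl) → ⊥-elim (false≢true (trans (sym (before-blocked zs z≢b)) bd))
    (yes refl , no z≢b , no z≢d) →
      trans (before-here z d zs) (occurs-∈ (before⇒∈ zs (trans (sym (before-skip zs z≢b z≢d)) bd)))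
    (no z≢a , yes refl , _) → ⊥-elim (false≢true (trans (sym (before-blocked zs z≢a)) ab))
    (no z≢a , no z≢b , yes refl) → ⊥-elim (false≢true (trans (sym (before-blocked zs z≢b)) bd))
    (no z≢a , no z≢b , no z≢d) → trans (before-skip zs z≢a z≢d)
      (before-trans zs (trans (sym (before-skip zs z≢a z≢b)) ab) (trans (sym (before-skip zs z≢b z≢d)) bd))

  before-asym : ∀ {a b : Fin n} zs → a ≢ b → before a b zs ≡ true → before b a zs ≡ true → ⊥
  before-asym {a} {b} (z ∷ zs) a≢b ab ba = case ((z ≟ a) , (z ≟ b)) of λ where
    (yes refl , _) → false≢true (trans (sym (before-blocked zs a≢b)) ba)
    (no z≢a , yes refl) → false≢true (trans (sym (before-blocked zs z≢a)) ab)
    (no z≢a , no z≢b) →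
      before-asym zs a≢b (trans (sym (before-skip zs z≢a z≢b)) ab) (trans (sym (before-skip zs z≢b z≢a)) ba)

  before-cyclic : ∀ {a b d : Fin n} zs → d ≢ a →
                  χ (before a b zs) + χ (before b d zs) + χ (before d a zs) ≤ 2
  before-cyclic {a} {b} {d} zs d≢a with before a b zs in ab | before b d zs in bd | before d a zs in da
  ... | true | true | true = ⊥-elim (before-asym zs (d≢a ∘ sym) (before-trans zs ab bd) da)
  ... | false | false | false = z≤n
  ... | false | false | true = s≤s z≤n
  ... | false | true | false = s≤s z≤n
  ... | false | true | true = ≤-refl
  ... | true | false | false = s≤s z≤n
  ... | true | false | true = ≤-refl
  ... | true | true | false = ≤-refl

position : ∀ {n} → Fin n → List (Fin n) → ℕ
position y [] = 0
position y (z ∷ zs) with does (z ≟ y)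
... | true = 0
... | false = suc (position y zs)

module _ {n : ℕ} where

  position-here : ∀ (y : Fin n) zs → position y (y ∷ zs) ≡ 0
  position-here y zs rewrite dec-true (y ≟ y) refl = refl

  position-skip : ∀ {y z : Fin n} zs → z ≢ y → position y (z ∷ zs) ≡ suc (position y zs)
  position-skip {y} {z} zs z≢y rewrite dec-false (z ≟ y) z≢y = refl

  position-< : ∀ {y : Fin n} zs → y ∈ zs → position y zs < length zs
  position-< {y} (z ∷ zs) y∈ = case (z ≟ y) of λ where
    (yes refl) → subst (_< suc (length zs)) (sym (position-here z zs)) (s≤s z≤n)
    (no z≢y) → subst (_< suc (length zs)) (sym (position-skip zs z≢y)) (s≤s (position-< zs (∈-tail z≢y y∈)))

  position-counts-predecessors : ∀ {y : Fin n} zs → Unique zs → y ∈ zs →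
                                 position y zs ≡ ΣF n (λ w → χ (before w y zs))
  position-counts-predecessors {y} (z ∷ zs) u y∈ = case (z ≟ y) of λ where
      (yes refl) → trans (position-here z zs) (sym (Σ-zero (allFin n) (λ w _ → nothing-precedes-head w)))
      (no z≢y) → begin
        position y (z ∷ zs) ≡⟨ position-skip zs z≢y ⟩
        suc (position y zs) ≡⟨ cong suc (position-counts-predecessors zs (unique-tail u) (∈-tail z≢y y∈)) ⟩
        1 + ΣF n (λ w → χ (before w y zs))
          ≡⟨ cong (_+ ΣF n (λ w → χ (before w y zs))) (sym (ΣF-single n z)) ⟩
        ΣF n (λ w → χ? (w ≟ z)) + ΣF n (λ w → χ (before w y zs))
          ≡⟨ sym (Σ-+ (λ w → χ? (w ≟ z)) (λ w → χ (before w y zs)) (allFin n)) ⟩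
        ΣF n (λ w → χ? (w ≟ z) + χ (before w y zs)) ≡⟨ Σ-cong (allFin n) (λ w _ → head-precedes z≢y w) ⟩
        ΣF n (λ w → χ (before w y (z ∷ zs))) ∎
    where
    open ≡-Reasoning
    nothing-precedes-head : ∀ w → χ (before w z (z ∷ zs)) ≡ 0
    nothing-precedes-head w = case (w ≟ z) of λ where
      (yes refl) → cong χ (trans (before-here w w zs) (occurs-∉ zs (head-∉-tail u)))
      (no w≢z) → cong χ (before-blocked zs (λ z≡w → w≢z (sym z≡w)))
    -- otherwise the head z precedes y, and w ≠ z precedes y iff it does in zs
    head-precedes : z ≢ y → ∀ w → χ? (w ≟ z) + χ (before w y zs) ≡ χ (before w y (z ∷ zs))
    head-precedes z≢y w = case (w ≟ z) of λ where
      (yes refl) → trans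
        (cong₂ _+_ (χ?-yes (w ≟ w) refl) (cong χ (before-∉-left zs (head-∉-tail u))))
        (sym (cong χ (trans (before-here w y zs) (occurs-∈ (∈-tail z≢y y∈)))))
      (no w≢z) → trans
        (cong (_+ χ (before w y zs)) (χ?-no (w ≟ z) w≢z))
        (sym (cong χ (before-skip zs (λ z≡w → w≢z (sym z≡w)) z≢y)))

_≤ᵇ_ : ℕ → ℕ → Bool
zero ≤ᵇ _ = true
suc k ≤ᵇ zero = false
suc k ≤ᵇ suc i = k ≤ᵇ i

count-≤ᵇ : ∀ m i → i < m → ΣF m (λ k → χ (toℕ k ≤ᵇ i)) ≡ suc i
count-≤ᵇ (suc m) zero _ =
  trans (ΣF-suc m (λ k → χ (toℕ k ≤ᵇ zero))) (cong suc (Σ-zero (allFin m) (λ _ _ → refl)))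
count-≤ᵇ (suc m) (suc i) (s≤s i<m) =
  trans (ΣF-suc m (λ k → χ (toℕ k ≤ᵇ suc i))) (cong suc (count-≤ᵇ m i i<m))

-- Inserting x into a list at position k (at the end if k exceeds its length).
module Insertion {n : ℕ} (x : Fin n) where

  insertAt : ℕ → List (Fin n) → List (Fin n)
  insertAt zero zs = x ∷ zs
  insertAt (suc k) [] = x ∷ []
  insertAt (suc k) (z ∷ zs) = z ∷ insertAt k zs

  occurs-insertAt : ∀ {b : Fin n} k zs → b ≢ x → occurs b (insertAt k zs) ≡ occurs b zs
  occurs-insertAt zero zs b≢x = occurs-skip zs (λ x≡b → b≢x (sym x≡b))
  occurs-insertAt (suc k) [] b≢x = occurs-skip [] (λ x≡b → b≢x (sym x≡b))
  occurs-insertAt {b} (suc k) (z ∷ zs) b≢x = case (z ≟ b) of λ where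
    (yes refl) → trans (occurs-here z (insertAt k zs)) (sym (occurs-here z zs))
    (no z≢b) → trans (occurs-skip (insertAt k zs) z≢b) (trans (occurs-insertAt k zs b≢x) (sym (occurs-skip zs z≢b)))

  before-insertAt : ∀ {a b : Fin n} k zs → a ≢ x → b ≢ x → before a b (insertAt k zs) ≡ before a b zs
  before-insertAt zero zs a≢x b≢x = before-skip zs (λ x≡a → a≢x (sym x≡a)) (λ x≡b → b≢x (sym x≡b))
  before-insertAt (suc k) [] a≢x b≢x = before-skip [] (λ x≡a → a≢x (sym x≡a)) (λ x≡b → b≢x (sym x≡b))
  before-insertAt {a} {b} (suc k) (z ∷ zs) a≢x b≢x = case ((z ≟ a) , (z ≟ b)) of λ where
    (yes refl , _) → trans (before-here z b (insertAt k zs)) (trans (occurs-insertAt k zs b≢x) (sym (before-here z b zs)))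
    (no z≢a , yes refl) → trans (before-blocked (insertAt k zs) z≢a) (sym (before-blocked zs z≢a))
    (no z≢a , no z≢b) →
      trans (before-skip (insertAt k zs) z≢a z≢b) (trans (before-insertAt k zs a≢x b≢x) (sym (before-skip zs z≢a z≢b)))

  before-x-insertAt : ∀ {y : Fin n} k zs → x ∉ zs → y ∈ zs → y ≢ x →
                      before x y (insertAt k zs) ≡ k ≤ᵇ position y zs
  before-x-insertAt zero zs _ y∈ _ = trans (before-here x _ zs) (occurs-∈ y∈)
  before-x-insertAt {y} (suc k) (z ∷ zs) x∉ y∈ y≢x = case (z ≟ y) of λ where
    (yes refl) → trans (before-blocked (insertAt k zs) y≢x) (cong (suc k ≤ᵇ_) (sym (position-here z zs)))
    (no z≢y) → trans (before-skip (insertAt k zs) (λ z≡x → x∉ (here (sym z≡x))) z≢y)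
      (trans (before-x-insertAt k zs (x∉ ∘ there) (∈-tail z≢y y∈) y≢x)
             (cong (suc k ≤ᵇ_) (sym (position-skip zs z≢y))))

  insertAt-++ : ∀ as bs → insertAt (length as) (as ++ bs) ≡ as ++ x ∷ bs
  insertAt-++ [] bs = refl
  insertAt-++ (a ∷ as) bs = cong (a ∷_) (insertAt-++ as bs)

  insertAt-adjacent : ∀ k zs → k < length zs →
                      ∃ λ as → ∃₂ λ a bs → insertAt k zs ≡ as ++ x ∷ a ∷ bs × insertAt (suc k) zs ≡ as ++ a ∷ x ∷ bs
  insertAt-adjacent zero (a ∷ bs) _ = [] , a , bs , refl , refl
  insertAt-adjacent (suc k) (z ∷ zs) (s≤s k<) with insertAt-adjacent k zs k<
  ... | as , a , bs , e₁ , e₂ = z ∷ as , a , bs , cong (z ∷_) e₁ , cong (z ∷_) e₂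

  insertAt-injective : ∀ {k k' τ τ'} → x ∉ τ → x ∉ τ' → k ≤ length τ → k' ≤ length τ' →
                       insertAt k τ ≡ insertAt k' τ' → k ≡ k' × τ ≡ τ'
  insertAt-injective {zero} {zero} _ _ _ _ refl = refl , refl
  insertAt-injective {zero} {suc k'} {_} {a ∷ τ'} _ x∉τ' _ _ refl = ⊥-elim (x∉τ' (here refl))
  insertAt-injective {suc k} {zero} {a ∷ τ} {_} x∉τ _ _ _ refl = ⊥-elim (x∉τ (here refl))
  insertAt-injective {suc k} {suc k'} {a ∷ τ} {b ∷ τ'} x∉τ x∉τ' (s≤s k≤) (s≤s k'≤) e
    with refl , e′ ← ∷-injective e
    with refl , refl ← insertAt-injective (x∉τ ∘ there) (x∉τ' ∘ there) k≤ k'≤ e′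
    = refl , refl

map-unique : ∀ {a b} {A : Set a} {B : Set b} (f : A → B) (xs : List A) →
             (∀ {p q} → p ∈ xs → q ∈ xs → f p ≡ f q → p ≡ q) → Unique xs → Unique (map f xs)
map-unique f [] _ [] = []
map-unique f (a ∷ xs) f-inj (a∉ ∷ u) =
  All.map⁺ (All.tabulate (λ q∈ e → All.lookup a∉ q∈ (f-inj (here refl) (there q∈) e))) ∷
  map-unique f xs (λ p∈ q∈ → f-inj (there p∈) (there q∈)) u

length-filter-T? : ∀ {a} {A : Set a} (f : A → Bool) xs →
                   length (filter (λ σ → T? (f σ)) xs) ≡ ΣL (λ σ → χ (f σ)) xs
length-filter-T? f [] = refl
length-filter-T? f (a ∷ xs) with f a
... | true = cong suc (length-filter-T? f xs)
... | false = length-filter-T? f xs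

module Decomposition {n : ℕ} (x : Fin n) (Ω : List (Ordering n))
  (total : All IsTotalOrdering Ω) (Ω-unique : Unique Ω) (independent : IndependentElement Ω x) where

  open Insertion x

  ordering-length : ∀ {σ} → σ ∈ Ω → length σ ≡ n
  ordering-length σ∈ = trans (↭-length (All.lookup total σ∈)) (length-tabulate (λ i → i))

  ordering-unique : ∀ {σ} → σ ∈ Ω → Unique σ
  ordering-unique {σ} σ∈ =
    PermSetoid.Unique-resp-↭ (setoid (Fin n)) (↭⇒↭ₛ (↭-sym (All.lookup total σ∈))) (allFin⁺ n)

  ordering-complete : ∀ {σ} → σ ∈ Ω → ∀ z → z ∈ σ
  ordering-complete σ∈ z = ∈-resp-↭ (↭-sym (All.lookup total σ∈)) (∈-allFin z)

  StartsWithX : List (Fin n) → Set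
  StartsWithX [] = ⊥
  StartsWithX (a ∷ _) = a ≡ x

  startsWithX? : ∀ σ → Dec (StartsWithX σ)
  startsWithX? [] = no (λ ())
  startsWithX? (a ∷ _) = a ≟ x

  tail : List (Fin n) → List (Fin n)
  tail [] = []
  tail (_ ∷ as) = as

  T : List (List (Fin n))
  T = map tail (filter startsWithX? Ω)

  T⇒Ω : ∀ {τ} → τ ∈ T → (x ∷ τ) ∈ Ω
  T⇒Ω τ∈ with ∈-map⁻ tail τ∈
  ... | σ , σ∈ , refl with ∈-filter⁻ startsWithX? {xs = Ω} σ∈
  ...   | σ∈Ω , starts with σ | starts
  ...     | a ∷ as | refl = σ∈Ω

  Ω⇒T : ∀ {τ} → (x ∷ τ) ∈ Ω → τ ∈ T
  Ω⇒T x∷τ∈ = ∈-map⁺ tail (∈-filter⁺ startsWithX? x∷τ∈ refl)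

  T-unique : Unique T
  T-unique = map-unique tail _ tail-injective (filter⁺ startsWithX? Ω-unique)
    where
    tail-injective : ∀ {p q} → p ∈ filter startsWithX? Ω → q ∈ filter startsWithX? Ω → tail p ≡ tail q → p ≡ q
    tail-injective {p} {q} p∈ q∈ e with ∈-filter⁻ startsWithX? {xs = Ω} p∈ | ∈-filter⁻ startsWithX? {xs = Ω} q∈
    tail-injective {a ∷ as} {b ∷ bs} _ _ refl | _ , refl | _ , refl = refl

  module Restricted {τ} (τ∈T : τ ∈ T) where
    x∉ : x ∉ τ
    x∉ = head-∉-tail (ordering-unique (T⇒Ω τ∈T))

    unique : Unique τ
    unique = unique-tail (ordering-unique (T⇒Ω τ∈T))

    complete : ∀ z → z ≢ x → z ∈ τ
    complete z z≢x = ∈-tail (λ x≡z → z≢x (sym x≡z)) (ordering-complete (T⇒Ω τ∈T) z)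

    length-τ : suc (length τ) ≡ n
    length-τ = ordering-length (T⇒Ω τ∈T)

  move-right : ∀ k zs → k < length zs → insertAt k zs ∈ Ω → insertAt (suc k) zs ∈ Ω
  move-right k zs k< σ∈ with insertAt-adjacent k zs k<
  ... | as , a , bs , e₁ , e₂ = subst (_∈ Ω) (sym e₂) (proj₂ (independent as bs a) (subst (_∈ Ω) e₁ σ∈))

  move-left : ∀ k zs → k < length zs → insertAt (suc k) zs ∈ Ω → insertAt k zs ∈ Ω
  move-left k zs k< σ∈ with insertAt-adjacent k zs k<
  ... | as , a , bs , e₁ , e₂ = subst (_∈ Ω) (sym e₁) (proj₁ (independent as bs a) (subst (_∈ Ω) e₂ σ∈))

  all-insertions : ∀ {τ} → (x ∷ τ) ∈ Ω → ∀ k → k ≤ length τ → insertAt k τ ∈ Ω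
  all-insertions x∷τ∈ zero _ = x∷τ∈
  all-insertions x∷τ∈ (suc k) k< = move-right k _ k< (all-insertions x∷τ∈ k (<⇒≤ k<))

  move-to-front : ∀ {τ} k → k ≤ length τ → insertAt k τ ∈ Ω → (x ∷ τ) ∈ Ω
  move-to-front zero _ σ∈ = σ∈
  move-to-front (suc k) k< σ∈ = move-to-front k (<⇒≤ k<) (move-left k _ k< σ∈)

  insertion : List (Fin n) × Fin n → List (Fin n)
  insertion (τ , k) = insertAt (toℕ k) τ

  pairs : List (List (Fin n) × Fin n)
  pairs = cartesianProduct T (allFin n)

  insertions : List (List (Fin n))
  insertions = map insertion pairs

  position-fits : ∀ {τ} → τ ∈ T → ∀ (k : Fin n) → toℕ k ≤ length τ
  position-fits τ∈ k = ≤-pred (subst (toℕ k <_) (sym (Restricted.length-τ τ∈)) (toℕ<n k))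

  insertions-unique : Unique insertions
  insertions-unique = map-unique insertion pairs insertion-injective (cartesianProduct⁺ T-unique (allFin⁺ n))
    where
    insertion-injective : ∀ {p q} → p ∈ pairs → q ∈ pairs → insertion p ≡ insertion q → p ≡ q
    insertion-injective {τ , k} {τ' , k'} p∈ q∈ e
      with τ∈ , _ ← ∈-cartesianProduct⁻ T (allFin n) p∈
      with τ'∈ , _ ← ∈-cartesianProduct⁻ T (allFin n) q∈
      with k≡k' , refl ← insertAt-injective (Restricted.x∉ τ∈) (Restricted.x∉ τ'∈)
                                              (position-fits τ∈ k) (position-fits τ'∈ k') e
      with refl ← toℕ-injective k≡k'
      = refl

  Ω⇒insertions : ∀ {σ} → σ ∈ Ω → σ ∈ insertions
  Ω⇒insertions {σ} σ∈ with ∈-∃++ (ordering-complete σ∈ x)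
  ... | as , bs , refl = subst (_∈ insertions) split
        (∈-map⁺ insertion (∈-cartesianProduct⁺ (Ω⇒T x-first) (∈-allFin (fromℕ< |as|<n))))
    where
    |as|≤ : length as ≤ length (as ++ bs)
    |as|≤ = subst (length as ≤_) (sym (length-++ as)) (m≤m+n _ _)
    |as|<n : length as < n
    |as|<n = begin-strict
      length as <⟨ m<m+n (length as) (s≤s z≤n) ⟩
      length as + suc (length bs) ≡⟨ length-++ as ⟨
      length (as ++ x ∷ bs) ≡⟨ ordering-length σ∈ ⟩
      n ∎
      where open ≤-Reasoning
    split : insertAt (toℕ (fromℕ< |as|<n)) (as ++ bs) ≡ as ++ x ∷ bs
    split = trans (cong (λ k → insertAt k (as ++ bs)) (toℕ-fromℕ< |as|<n)) (insertAt-++ as bs)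
    x-first : (x ∷ (as ++ bs)) ∈ Ω
    x-first = move-to-front (length as) |as|≤ (subst (_∈ Ω) (sym (insertAt-++ as bs)) σ∈)

  insertions⇒Ω : ∀ {σ} → σ ∈ insertions → σ ∈ Ω
  insertions⇒Ω σ∈ with ∈-map⁻ insertion σ∈
  ... | (τ , k) , p∈ , refl with ∈-cartesianProduct⁻ T (allFin n) p∈
  ...   | τ∈ , _ = all-insertions (T⇒Ω τ∈) (toℕ k) (position-fits τ∈ k)

  Ω↭insertions : Ω ↭ insertions
  Ω↭insertions = ∼bag⇒↭ (unique∧set⇒bag Ω-unique insertions-unique (mk⇔ Ω⇒insertions insertions⇒Ω))

  Σ-over-Ω : ∀ f → ΣL f Ω ≡ ΣL (λ τ → ΣF n (λ k → f (insertAt (toℕ k) τ))) T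
  Σ-over-Ω f = begin
      ΣL f Ω ≡⟨ Σ-↭ f Ω↭insertions ⟩
      ΣL f insertions ≡⟨ Σ-map f insertion pairs ⟩
      ΣL (f ∘ insertion) pairs ≡⟨ Σ-cartesian (f ∘ insertion) T (allFin n) ⟩
      ΣL (λ τ → ΣF n (λ k → f (insertAt (toℕ k) τ))) T ∎
    where open ≡-Reasoning

  M : ℕ
  M = length T

  c : Fin n → Fin n → ℕ
  c a b = ΣL (λ τ → χ (before a b τ)) T

  |Ω|≡n*M : length Ω ≡ n * M
  |Ω|≡n*M = begin
      length Ω ≡⟨ Σ-1 Ω ⟨
      ΣL (λ _ → 1) Ω ≡⟨ Σ-over-Ω (λ _ → 1) ⟩
      ΣL (λ _ → ΣF n (λ _ → 1)) T ≡⟨ cong (λ k → ΣL (λ _ → k) T) (trans (ΣF-const n 1) (*-identityʳ n)) ⟩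
      ΣL (λ _ → n) T ≡⟨ Σ-const n T ⟩
      M * n ≡⟨ *-comm M n ⟩
      n * M ∎
    where open ≡-Reasoning

  countBefore-as-sum : ∀ a b → countBefore a b Ω ≡ ΣL (λ σ → χ (before a b σ)) Ω
  countBefore-as-sum a b = length-filter-T? (before a b) Ω

  -- For a, b ≠ x, each τ contributes its precedence n times.
  countBefore-off-x : ∀ a b → a ≢ x → b ≢ x → countBefore a b Ω ≡ n * c a b
  countBefore-off-x a b a≢x b≢x = begin
      countBefore a b Ω ≡⟨ countBefore-as-sum a b ⟩
      ΣL (λ σ → χ (before a b σ)) Ω ≡⟨ Σ-over-Ω _ ⟩
      ΣL (λ τ → ΣF n (λ k → χ (before a b (insertAt (toℕ k) τ)))) T
        ≡⟨ Σ-cong T (λ τ _ → Σ-cong (allFin n) (λ k _ → cong χ (before-insertAt (toℕ k) τ a≢x b≢x))) ⟩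
      ΣL (λ τ → ΣF n (λ _ → χ (before a b τ))) T ≡⟨ Σ-cong T (λ τ _ → ΣF-const n _) ⟩
      ΣL (λ τ → n * χ (before a b τ)) T ≡⟨ Σ-* n (λ τ → χ (before a b τ)) T ⟩
      n * c a b ∎
    where open ≡-Reasoning

  -- For y ≠ x, x precedes y in position(y) + 1 of the n insertions into τ.
  countBefore-x : ∀ y → y ≢ x → countBefore x y Ω ≡ M + ΣF n (λ z → c z y)
  countBefore-x y y≢x = begin
      countBefore x y Ω ≡⟨ countBefore-as-sum x y ⟩
      ΣL (λ σ → χ (before x y σ)) Ω ≡⟨ Σ-over-Ω _ ⟩
      ΣL (λ τ → ΣF n (λ k → χ (before x y (insertAt (toℕ k) τ)))) T
        ≡⟨ Σ-cong T (λ τ τ∈ → Σ-cong (allFin n) (λ k _ → cong χ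
             (before-x-insertAt (toℕ k) τ (Restricted.x∉ τ∈) (Restricted.complete τ∈ y y≢x) y≢x))) ⟩
      ΣL (λ τ → ΣF n (λ k → χ (toℕ k ≤ᵇ position y τ))) T
        ≡⟨ Σ-cong T (λ τ τ∈ → count-≤ᵇ n (position y τ) (position-<n τ τ∈)) ⟩
      ΣL (λ τ → 1 + position y τ) T
        ≡⟨ Σ-cong T (λ τ τ∈ → cong suc
             (position-counts-predecessors τ (Restricted.unique τ∈) (Restricted.complete τ∈ y y≢x))) ⟩
      ΣL (λ τ → 1 + ΣF n (λ z → χ (before z y τ))) T ≡⟨ Σ-+ (λ _ → 1) _ T ⟩
      ΣL (λ _ → 1) T + ΣL (λ τ → ΣF n (λ z → χ (before z y τ))) T
        ≡⟨ cong₂ _+_ (Σ-1 T) (Σ-comm (λ τ z → χ (before z y τ)) T (allFin n)) ⟩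
      M + ΣF n (λ z → c z y) ∎
    where
    open ≡-Reasoning
    position-<n : ∀ τ → τ ∈ T → position y τ < n
    position-<n τ τ∈ = <-trans (position-< τ (Restricted.complete τ∈ y y≢x)) (≤-reflexive (Restricted.length-τ τ∈))

  c-complement : ∀ a b → a ≢ b → a ≢ x → b ≢ x → c a b + c b a ≡ M
  c-complement a b a≢b a≢x b≢x = begin
      c a b + c b a ≡⟨ Σ-+ (λ τ → χ (before a b τ)) (λ τ → χ (before b a τ)) T ⟨
      ΣL (λ τ → χ (before a b τ) + χ (before b a τ)) T
        ≡⟨ Σ-cong T (λ τ τ∈ → before-total τ (Restricted.complete τ∈ a a≢x) (Restricted.complete τ∈ b b≢x) a≢b) ⟩
      ΣL (λ _ → 1) T ≡⟨ Σ-1 T ⟩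
      M ∎
    where open ≡-Reasoning

  c-cyclic : ∀ a b d → a ≢ b → b ≢ d → d ≢ a → a ≢ x → b ≢ x → d ≢ x → c a b + c b d + c d a ≤ 2 * M
  c-cyclic a b d _ _ d≢a _ _ _ = begin
      c a b + c b d + c d a
        ≡⟨ cong (_+ c d a) (Σ-+ (λ τ → χ (before a b τ)) (λ τ → χ (before b d τ)) T) ⟨
      ΣL (λ τ → χ (before a b τ) + χ (before b d τ)) T + c d a
        ≡⟨ Σ-+ (λ τ → χ (before a b τ) + χ (before b d τ)) (λ τ → χ (before d a τ)) T ⟨
      ΣL (λ τ → χ (before a b τ) + χ (before b d τ) + χ (before d a τ)) T
        ≤⟨ Σ-mono T (λ τ _ → before-cyclic τ d≢a) ⟩
      ΣL (λ _ → 2) T ≡⟨ Σ-const 2 T ⟩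
      M * 2 ≡⟨ *-comm M 2 ⟩
      2 * M ∎
    where open ≤-Reasoning

  c-x-left : ∀ y → c x y ≡ 0
  c-x-left y = Σ-zero T (λ τ τ∈ → cong χ (before-∉-left τ (Restricted.x∉ τ∈)))

  c-x-right : ∀ y → c y x ≡ 0
  c-x-right y = Σ-zero T (λ τ τ∈ → cong χ (before-∉-right τ (Restricted.x∉ τ∈)))

  c-diag : ∀ y → c y y ≡ 0
  c-diag y = Σ-zero T (λ τ τ∈ → cong χ (before-irrefl y τ (Restricted.unique τ∈)))

  off-x-pair-balanced : ∀ {a b} → a ≢ x → b ≢ x → a ≢ b →
                        M ≤ 3 * c a b → 3 * c a b ≤ 2 * M → BalancedPair Ω a b
  off-x-pair-balanced {a} {b} a≢x b≢x a≢b lower upper =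
    a≢b , subst₂ _≤_ (sym |Ω|≡n*M) 3·count (*-monoʳ-≤ n lower) ,
          subst₂ _≤_ 3·count (trans (swap n 2 M) (cong (2 *_) (sym |Ω|≡n*M))) (*-monoʳ-≤ n upper)
    where
    swap : ∀ n k m → n * (k * m) ≡ k * (n * m)
    swap = solve-∀
    3·count : n * (3 * c a b) ≡ 3 * countBefore a b Ω
    3·count = trans (swap n 3 (c a b)) (cong (3 *_) (sym (countBefore-off-x a b a≢x b≢x)))

  x-pair-balanced : ∀ {y} → y ≢ x → n * M ≤ 3 * (M + ΣF n (λ z → c z y)) →
                    3 * (M + ΣF n (λ z → c z y)) ≤ 2 * (n * M) → BalancedPair Ω x y
  x-pair-balanced {y} y≢x lower upper =
    (λ x≡y → y≢x (sym x≡y)) ,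
    subst₂ _≤_ (sym |Ω|≡n*M) 3·count lower ,
    subst₂ _≤_ 3·count (cong (2 *_) (sym |Ω|≡n*M)) upper
    where
    3·count : 3 * (M + ΣF n (λ z → c z y)) ≡ 3 * countBefore x y Ω
    3·count = cong (3 *_) (sym (countBefore-x y y≢x))

module _ {t : ℕ} (x : Fin (2 + t)) (Ω : List (Ordering (2 + t)))
         (total : All IsTotalOrdering Ω) (Ω-unique : Unique Ω) (independent : IndependentElement Ω x) where

  open Decomposition x Ω total Ω-unique independent

  independent⇒balanced : Balanced Ω
  independent⇒balanced with Tournament.tournament x M c c-complement c-cyclic c-x-left c-x-right c-diag
  ... | inj₁ (a , b , a≢x , b≢x , a≢b , lower , upper) = inj₁ (a , b , off-x-pair-balanced a≢x b≢x a≢b lower upper)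
  ... | inj₂ (y , y≢x , lower , upper) = inj₁ (x , y , x-pair-balanced y≢x lower upper)

constant-unique⇒length-1 : ∀ {a} {A : Set a} (c₀ : A) (xs : List A) →
                           (∀ {σ} → σ ∈ xs → σ ≡ c₀) → Unique xs → xs ≢ [] → length xs ≡ 1
constant-unique⇒length-1 c₀ [] _ _ nonempty = ⊥-elim (nonempty refl)
constant-unique⇒length-1 c₀ (a ∷ []) _ _ _ = refl
constant-unique⇒length-1 c₀ (a ∷ b ∷ xs) constant (a∉ ∷ _) _ =
  ⊥-elim (All.lookup a∉ (here refl) (trans (constant (here refl)) (sym (constant (there (here refl))))))

theorem1 : ∀ (n : ℕ) (Ω : List (Ordering n)) → IsSetOfOrderings Ω →
           (∃[ x ] IndependentElement Ω x) → Balanced Ω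
theorem1 zero Ω _ (() , _)
theorem1 (suc zero) Ω (total , Ω-unique , nonempty) _ =
  inj₂ (constant-unique⇒length-1 (zero ∷ []) Ω (λ σ∈ → ↭-singleton-inv (All.lookup total σ∈)) Ω-unique nonempty)
theorem1 (suc (suc t)) Ω (total , Ω-unique , _) (x , independent) =
  independent⇒balanced x Ω total Ω-unique independent
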